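{- Let $G$ be an eulerian graph and let $k$ be a positive integer with $k\equiv |E(G)|\pmod 2$. Then $G$ admits a $k$-odd decomposition if and only if $G$ contains at least $k$ pairwise edge-disjoint circuits of odd length.
   Context: Graphs are finite and may have multiple edges and loops. A graph is eulerian if it is connected and every vertex has even degree. A decomposition of a graph $G$ is a set $\{G_1,\dots,G_k\}$ of subgraphs of $G$ whose edge sets partition $E(G)$. A decomposition $\{G_1,\dots,G_k\}$ is $k$-odd if each $G_i$ is an eulerian subgraph (a closed trail) with an odd number of edges. A circuit is a closed trail whose inner vertices are distinct (loops count as circuits of length $1$). -}

module Defs where

open import Data.Nat using (ℕ; zero; suc; _+_)
open import Data.Nat.Divisibility using (_∣_)
open import Data.Fin using (Fin; _≟_)
open import Data.Bool using (Bool; true; false)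
open import Data.Product using (_×_; _,_; proj₁; proj₂; Σ; ∃; ∃-syntax)
open import Data.List using (List; []; _∷_; map; length; allFin)
open import Data.Nat.ListAction using (sum)
open import Data.List.Membership.Propositional using (_∈_)
open import Data.List.Relation.Unary.Unique.Propositional using (Unique)
open import Data.Unit using (⊤)
open import Data.Empty using (⊥)
open import Relation.Binary.PropositionalEquality using (_≡_; _≢_)
open import Relation.Nullary using (¬_; yes; no)
open import Function.Bundles using (_⇔_)

-- A finite multigraph (loops and parallel edges allowed):
-- vertices Fin V, edges Fin E, each edge has an (ordered, arbitrary) pair of ends.
-- A loop is an edge whose two ends coincide.
record Graph : Set where
  field
    V    : ℕ
    E    : ℕ
    ends : Fin E → Fin V × Fin V
open Graph public

module _ (G : Graph) where

  -- a dart = an edge together with a direction of traversal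
  Dart : Set
  Dart = Fin (E G) × Bool

  tail : Dart → Fin (V G)
  tail (e , true)  = proj₁ (ends G e)
  tail (e , false) = proj₂ (ends G e)

  head : Dart → Fin (V G)
  head (e , true)  = proj₂ (ends G e)
  head (e , false) = proj₁ (ends G e)

  edgeOf : Dart → Fin (E G)
  edgeOf = proj₁

  Consecutive : List Dart → Set
  Consecutive []              = ⊤
  Consecutive (d ∷ [])        = ⊤
  Consecutive (d ∷ d′ ∷ ds)   = (head d ≡ tail d′) × Consecutive (d′ ∷ ds)

  lastHead : Dart → List Dart → Fin (V G)
  lastHead d []        = head d
  lastHead d (x ∷ xs)  = lastHead x xs

  Walk : Fin (V G) → Fin (V G) → List Dart → Set
  Walk u v []        = u ≡ v
  Walk u v (d ∷ ds)  = (tail d ≡ u) × Consecutive (d ∷ ds) × (lastHead d ds ≡ v)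

  Connected : Set
  Connected = (u v : Fin (V G)) → ∃[ w ] Walk u v w

  -- degree: number of edge-ends at v (a loop contributes 2)
  endCount : Fin (V G) → Fin (V G) → ℕ
  endCount v w with v ≟ w
  ... | yes _ = 1
  ... | no  _ = 0

  degree : Fin (V G) → ℕ
  degree v = sum (map (λ e → endCount v (proj₁ (ends G e)) + endCount v (proj₂ (ends G e))) (allFin (E G)))

  Eulerian : Set
  Eulerian = Connected × ((v : Fin (V G)) → 2 ∣ degree v)

  ClosedTrail : List Dart → Set
  ClosedTrail []        = ⊥
  ClosedTrail (d ∷ ds)  = Walk (tail d) (tail d) (d ∷ ds) × Unique (map edgeOf (d ∷ ds))

  -- a circuit: a closed trail whose inner vertices (v₁,…,v_k = v₀) are distinct,
  -- i.e. the tails of its darts are pairwise distinct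
  Circuit : List Dart → Set
  Circuit ds = ClosedTrail ds × Unique (map tail ds)

  Odd : ℕ → Set
  Odd n = ¬ (2 ∣ n)

  TraversesExactly : List Dart → (Fin (E G) → Set) → Set
  TraversesExactly t P = (e : Fin (E G)) → (e ∈ map edgeOf t) ⇔ P e

  -- a k-odd decomposition: the edges are partitioned into k classes
  -- (class of e is c e), each class being the edge set of an eulerian
  -- subgraph, i.e. of a closed trail, with an odd number of edges
  -- (an odd class is nonempty, so the k classes are k distinct subgraphs)
  OddDecomposition : ℕ → Set
  OddDecomposition k =
    Σ (Fin (E G) → Fin k) λ c →
      (i : Fin k) → ∃[ t ] (ClosedTrail t × TraversesExactly t (λ e → c e ≡ i) × Odd (length t))

  OddCircuitPacking : ℕ → Set
  OddCircuitPacking k =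
    Σ (Fin k → List Dart) λ C →
      ((i : Fin k) → Circuit (C i) × Odd (length (C i))) ×
      ((i j : Fin k) → i ≢ j → (e : Fin (E G)) → e ∈ map edgeOf (C i) → ¬ (e ∈ map edgeOf (C j)))

-- An odd closed trail that repeats a vertex splits there into two
-- shorter closed trails, one of them odd; so each class of a k-odd decomposition contains an odd
-- circuit, and these circuits are edge-disjoint. Conversely, deleting k edge-disjoint odd circuits
-- from an eulerian graph leaves all degrees even, so the remaining edges split greedily into closed
-- trails. In the resulting decomposition at least k trails are odd, and their number has the parity
-- of |E(G)|, hence of k. By connectivity, when there are at least two trails some two of them share
-- a vertex and merge into one closed trail: merging an even trail into a neighbour keeps the number
-- of odd trails, merging two odd trails lowers it by two, and either way the number of trails drops,
-- until exactly k trails remain, all odd.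
module Submission where

open import Data.Bool using (true; false)
open import Data.Empty using (⊥-elim)
open import Data.Fin using (Fin; zero; suc; _≟_)
open import Data.List using (List; []; _∷_; _++_; [_]; map; concat; concatMap; lookup; length; tabulate; allFin)
open import Data.List.Properties
  using (map-++; map-tabulate; concatMap-++; length-map; length-++; length-tabulate; ++-assoc; ++-conicalˡ; ++-conicalʳ)
open import Data.List.Membership.Propositional using (_∈_; find)
open import Data.List.Membership.Propositional.Properties
  using (∈-++⁺ˡ; ∈-++⁺ʳ; ∈-++⁻; ∈-∃++; ∈-map⁺; ∈-map⁻; ∈-concat⁺′; ∈-concatMap⁻; ∈-lookup; ∈-allFin; ∈-tabulate⁺)
import Data.List.Membership.DecPropositional as DecMembership
open import Data.List.Relation.Unary.All using (All; []; _∷_; all?)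
import Data.List.Relation.Unary.All as All
import Data.List.Relation.Unary.All.Properties as AllP
open import Data.List.Relation.Unary.AllPairs using ([]; _∷_)
import Data.List.Relation.Unary.AllPairs.Properties as AllPairsP
open import Data.List.Relation.Unary.Any using (Any; here; there)
import Data.List.Relation.Unary.Any as Any
open import Data.List.Relation.Unary.Any.Properties using (lookup-index)
open import Data.List.Relation.Unary.Unique.Propositional using (Unique)
open import Data.List.Relation.Unary.Unique.Propositional.Properties using (allFin⁺; concat⁺)
open import Data.List.Relation.Binary.Disjoint.Propositional using (Disjoint)
open import Data.List.Relation.Binary.Subset.Propositional using (_⊆_)
open import Data.List.Relation.Binary.Permutation.Propositional
  using (_↭_; prep; swap; ↭-refl; ↭-reflexive; ↭-sym; ↭-trans; ↭⇒↭ₛ)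
import Data.List.Relation.Binary.Permutation.Propositional as ↭
open import Data.List.Relation.Binary.Permutation.Propositional.Properties
  using (shift; shifts; ++⁺; ++⁺ˡ; ++⁺ʳ; ++-comm; map⁺; ∈-resp-↭; All-resp-↭; ↭-length; ↭-empty-inv; drop-∷; ∷↭∷ʳ)
import Data.List.Relation.Binary.Permutation.Setoid.Properties as ↭ₛ
open import Data.Nat using (ℕ; zero; suc; _+_; _*_; _%_; _/_; _≤_; _<_; _>_; z≤n; s≤s; parity)
import Data.Nat as ℕ
open import Data.Nat.DivMod using (m≡m%n+[m/n]*n)
open import Data.Nat.Divisibility using (_∣_; divides; _∣0; ∣-refl; ∣m∣n⇒∣m+n)
open import Data.Nat.Induction using (<-wellFounded)
open import Data.Nat.ListAction using (sum)
open import Data.Nat.ListAction.Properties using (sum-++; sum-↭)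
open import Data.Nat.Properties
  using (0≢1+n; m≤m+n; m<m+n; <-irrefl; ≤-reflexive; ≤-trans; +-cancelˡ-≤; module ≤-Reasoning)
open import Data.Parity.Base using (Parity; 0ℙ; 1ℙ; _⁻¹) renaming (_+_ to _⊕_)
open import Data.Parity.Properties using (+-homo-+; *-homo-*; *-zeroʳ; suc-homo-⁻¹; p+p≡0ℙ)
import Data.Parity.Properties as ℙ
open import Data.Product using (_×_; _,_; proj₁; proj₂; ∃-syntax)
open import Data.Sum using (_⊎_; inj₁; inj₂)
open import Function using (_∘_; id; case_of_)
open import Function.Bundles using (_⇔_; mk⇔; Equivalence)
open import Induction.WellFounded using (Acc; acc)
open import Relation.Binary.Definitions using (DecidableEquality)
open import Relation.Binary.PropositionalEquality
  using (_≡_; _≢_; refl; sym; trans; cong; cong₂; subst; setoid; module ≡-Reasoning)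
open import Relation.Nullary using (¬_; yes; no)
open import Relation.Unary using (Decidable)

open import Defs

2∣⇒parity≡0ℙ : ∀ {n} → 2 ∣ n → parity n ≡ 0ℙ
2∣⇒parity≡0ℙ (divides q refl) = trans (*-homo-* q 2) (*-zeroʳ (parity q))

parity≡0ℙ⇒2∣ : ∀ n → parity n ≡ 0ℙ → 2 ∣ n
parity≡0ℙ⇒2∣ zero          _ = 2 ∣0
parity≡0ℙ⇒2∣ (suc (suc n)) p = ∣m∣n⇒∣m+n ∣-refl (parity≡0ℙ⇒2∣ n p)

parity≡1ℙ⇒¬2∣ : ∀ {n} → parity n ≡ 1ℙ → ¬ 2 ∣ n
parity≡1ℙ⇒¬2∣ p 2∣n with () ← trans (sym p) (2∣⇒parity≡0ℙ 2∣n)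

¬2∣⇒parity≡1ℙ : ∀ n → ¬ 2 ∣ n → parity n ≡ 1ℙ
¬2∣⇒parity≡1ℙ n ¬2∣n with parity n in eq
... | 1ℙ = refl
... | 0ℙ = ⊥-elim (¬2∣n (parity≡0ℙ⇒2∣ n eq))

parity-%2 : ∀ n → parity (n % 2) ≡ parity n
parity-%2 n = sym (begin
  parity n                               ≡⟨ cong parity (m≡m%n+[m/n]*n n 2) ⟩
  parity (n % 2 + n / 2 * 2)             ≡⟨ +-homo-+ (n % 2) (n / 2 * 2) ⟩
  parity (n % 2) ⊕ parity (n / 2 * 2)    ≡⟨ cong (parity (n % 2) ⊕_) (2∣⇒parity≡0ℙ (divides (n / 2) refl)) ⟩
  parity (n % 2) ⊕ 0ℙ                    ≡⟨ ℙ.+-identityʳ (parity (n % 2)) ⟩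
  parity (n % 2)                         ∎)
  where open ≡-Reasoning

%2≡⇒parity≡ : ∀ m n → m % 2 ≡ n % 2 → parity m ≡ parity n
%2≡⇒parity≡ m n m≡n = trans (sym (parity-%2 m)) (trans (cong parity m≡n) (parity-%2 n))

⊕-cancel-middle : ∀ a b c → (a ⊕ b) ⊕ (b ⊕ c) ≡ a ⊕ c
⊕-cancel-middle a b c = begin
  (a ⊕ b) ⊕ (b ⊕ c)   ≡⟨ ℙ.+-assoc a b (b ⊕ c) ⟩
  a ⊕ (b ⊕ (b ⊕ c))   ≡⟨ cong (a ⊕_) (sym (ℙ.+-assoc b b c)) ⟩
  a ⊕ ((b ⊕ b) ⊕ c)   ≡⟨ cong (λ p → a ⊕ (p ⊕ c)) (p+p≡0ℙ b) ⟩
  a ⊕ c               ∎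
  where open ≡-Reasoning

≤-parity-gap : ∀ {m n} → m ≤ n → parity m ≡ parity n → m ≢ n → 2 + m ≤ n
≤-parity-gap {zero}  {zero}        _         _  m≢n = ⊥-elim (m≢n refl)
≤-parity-gap {zero}  {suc zero}    _         ()
≤-parity-gap {zero}  {suc (suc n)} _         _  _   = s≤s (s≤s z≤n)
≤-parity-gap {suc m} {suc n}       (s≤s m≤n) p  m≢n = s≤s (≤-parity-gap m≤n parity-pred (m≢n ∘ cong suc))
  where
  parity-pred : parity m ≡ parity n
  parity-pred = trans (sym (suc-homo-⁻¹ m)) (trans (cong _⁻¹ p) (suc-homo-⁻¹ n))

module _ {A : Set} where

  ∈⇒↭∷ : ∀ {x : A} {xs} → x ∈ xs → ∃[ ys ] xs ↭ x ∷ ys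
  ∈⇒↭∷ {x} x∈xs with ys , zs , refl ← ∈-∃++ x∈xs = ys ++ zs , shift x ys zs

  ⊆⇒↭++ : ∀ {xs ys : List A} → Unique xs → xs ⊆ ys → ∃[ zs ] ys ↭ xs ++ zs
  ⊆⇒↭++ {[]}     {ys} _            _       = ys , ↭-refl
  ⊆⇒↭++ {x ∷ xs}      (x∉xs ∷ !xs) x∷xs⊆ys with ys′ , ys↭ ← ∈⇒↭∷ (x∷xs⊆ys (here refl)) =
    let zs , ys′↭ = ⊆⇒↭++ !xs xs⊆ys′ in zs , ↭-trans ys↭ (prep x ys′↭)
    where
    xs⊆ys′ : xs ⊆ ys′
    xs⊆ys′ z∈xs with ∈-resp-↭ ys↭ (x∷xs⊆ys (there z∈xs))
    ... | here refl   = ⊥-elim (All.lookup x∉xs z∈xs refl)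
    ... | there z∈ys′ = z∈ys′

  ++-unique⁻ : ∀ xs {ys : List A} → Unique (xs ++ ys) → Unique xs × Unique ys × Disjoint xs ys
  ++-unique⁻ []       !ys = [] , !ys , λ ()
  ++-unique⁻ (x ∷ xs) (x∉ ∷ !xs++ys) with !xs , !ys , disj ← ++-unique⁻ xs !xs++ys =
    AllP.++⁻ˡ xs x∉ ∷ !xs , !ys , λ where
      (here refl , v∈ys)  → All.lookup (AllP.++⁻ʳ xs x∉) v∈ys refl
      (there v∈xs , v∈ys) → disj (v∈xs , v∈ys)

  unique-resp-↭ : ∀ {xs ys : List A} → xs ↭ ys → Unique xs → Unique ys
  unique-resp-↭ xs↭ys = ↭ₛ.Unique-resp-↭ (setoid A) (↭⇒↭ₛ xs↭ys)

  concat-↭ : ∀ {xss yss : List (List A)} → xss ↭ yss → concat xss ↭ concat yss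
  concat-↭ ↭.refl         = ↭-refl
  concat-↭ (prep xs p)    = ++⁺ˡ xs (concat-↭ p)
  concat-↭ (swap xs ys p) = ↭-trans (shifts xs ys) (++⁺ˡ ys (++⁺ˡ xs (concat-↭ p)))
  concat-↭ (↭.trans p q)  = ↭-trans (concat-↭ p) (concat-↭ q)

  sum≢0⇒∃ : ∀ (f : A → ℕ) xs → sum (map f xs) ≢ 0 → ∃[ x ] x ∈ xs × f x ≢ 0
  sum≢0⇒∃ f []       sum≢0 = ⊥-elim (sum≢0 refl)
  sum≢0⇒∃ f (x ∷ xs) sum≢0 with f x in fx≡
  ... | suc _ = x , here refl , λ fx≡0 → 0≢1+n (trans (sym fx≡0) fx≡)
  ... | zero  with y , y∈xs , fy≢0 ← sum≢0⇒∃ f xs sum≢0 = y , there y∈xs , fy≢0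

  ↭++-shorterˡ : ∀ {xs : List A} ys zs → xs ↭ ys ++ zs → zs ≢ [] → length ys < length xs
  ↭++-shorterˡ ys []       _   zs≢[] = ⊥-elim (zs≢[] refl)
  ↭++-shorterˡ {xs} ys (z ∷ zs) xs↭ _     = begin-strict
    length ys                       <⟨ m<m+n (length ys) (s≤s z≤n) ⟩
    length ys + length (z ∷ zs)     ≡⟨ sym (length-++ ys) ⟩
    length (ys ++ z ∷ zs)           ≡⟨ ↭-length (↭-sym xs↭) ⟩
    length xs                 ∎
    where open ≤-Reasoning

  ↭++-shorterʳ : ∀ {xs : List A} ys zs → xs ↭ ys ++ zs → ys ≢ [] → length zs < length xs
  ↭++-shorterʳ ys zs xs↭ = ↭++-shorterˡ zs ys (↭-trans xs↭ (++-comm ys zs))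

  parity-length-↭++ : ∀ {xs : List A} ys zs → xs ↭ ys ++ zs →
    parity (length xs) ≡ parity (length ys) ⊕ parity (length zs)
  parity-length-↭++ ys zs xs↭ = trans (cong parity (trans (↭-length xs↭) (length-++ ys))) (+-homo-+ (length ys) _)

  ↭++-⊆ˡ : ∀ {xs : List A} ys zs → xs ↭ ys ++ zs → ys ⊆ xs
  ↭++-⊆ˡ ys zs xs↭ y∈ys = ∈-resp-↭ (↭-sym xs↭) (∈-++⁺ˡ y∈ys)

  ↭++-⊆ʳ : ∀ {xs : List A} ys zs → xs ↭ ys ++ zs → zs ⊆ xs
  ↭++-⊆ʳ ys zs xs↭ z∈zs = ∈-resp-↭ (↭-sym xs↭) (∈-++⁺ʳ ys z∈zs)

  module _ {B : Set} (f : A → B) (_≟ᴮ_ : DecidableEquality B) where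
    open DecMembership _≟ᴮ_ using () renaming (_∈?_ to _∈ᴮ?_)

    uniqueOrRepeated : ∀ xs → Unique (map f xs) ⊎
      ∃[ p ] ∃[ x ] ∃[ q ] ∃[ y ] ∃[ r ] xs ≡ p ++ x ∷ q ++ y ∷ r × f x ≡ f y
    uniqueOrRepeated []       = inj₁ []
    uniqueOrRepeated (x ∷ xs) with f x ∈ᴮ? map f xs
    ... | yes fx∈
      with y , y∈xs , fx≡fy ← ∈-map⁻ f fx∈
      with q , r , refl ← ∈-∃++ y∈xs
      = inj₂ ([] , x , q , y , r , refl , fx≡fy)
    ... | no fx∉ with uniqueOrRepeated xs
    ...   | inj₁ !xs = inj₁ (AllP.¬Any⇒All¬ (map f xs) fx∉ ∷ !xs)
    ...   | inj₂ (p , x′ , q , y , r , xs≡ , fx′≡fy) = inj₂ (x ∷ p , x′ , q , y , r , cong (x ∷_) xs≡ , fx′≡fy)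

module _ {A B : Set} (f : A → List B) where

  ∈-concatMap-lookup : ∀ (xs : List A) i {y} → y ∈ f (lookup xs i) → y ∈ concatMap f xs
  ∈-concatMap-lookup xs i y∈ = ∈-concat⁺′ y∈ (∈-map⁺ f (∈-lookup {xs = xs} i))

  concatMap-unique-index : ∀ (xs : List A) → Unique (concatMap f xs) →
    ∀ {y} i j → y ∈ f (lookup xs i) → y ∈ f (lookup xs j) → i ≡ j
  concatMap-unique-index (x ∷ xs) !fxs zero    zero    _   _   = refl
  concatMap-unique-index (x ∷ xs) !fxs zero    (suc j) y∈i y∈j =
    ⊥-elim (proj₂ (proj₂ (++-unique⁻ (f x) !fxs)) (y∈i , ∈-concatMap-lookup xs j y∈j))
  concatMap-unique-index (x ∷ xs) !fxs (suc i) zero    y∈i y∈j =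
    ⊥-elim (proj₂ (proj₂ (++-unique⁻ (f x) !fxs)) (y∈j , ∈-concatMap-lookup xs i y∈i))
  concatMap-unique-index (x ∷ xs) !fxs (suc i) (suc j) y∈i y∈j =
    cong suc (concatMap-unique-index xs (proj₁ (proj₂ (++-unique⁻ (f x) !fxs))) i j y∈i y∈j)

oddness : Parity → ℕ
oddness 0ℙ = 0
oddness 1ℙ = 1

parity-oddness : ∀ p → parity (oddness p) ≡ p
parity-oddness 0ℙ = refl
parity-oddness 1ℙ = refl

≢1ℙ⇒≡0ℙ : ∀ {p} → p ≢ 1ℙ → p ≡ 0ℙ
≢1ℙ⇒≡0ℙ {0ℙ} _    = refl
≢1ℙ⇒≡0ℙ {1ℙ} p≢1ℙ = ⊥-elim (p≢1ℙ refl)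

module _ {A : Set} where

  OddLength : List A → Set
  OddLength xs = parity (length xs) ≡ 1ℙ

  oddLength? : Decidable OddLength
  oddLength? xs = parity (length xs) ℙ.≟ 1ℙ

  oddCount : List (List A) → ℕ
  oddCount xss = sum (map (oddness ∘ parity ∘ length) xss)

  oddCount-↭ : ∀ {xss yss} → xss ↭ yss → oddCount xss ≡ oddCount yss
  oddCount-↭ xss↭ = sum-↭ (map⁺ (oddness ∘ parity ∘ length) xss↭)

  oddCount-++ : ∀ xss yss → oddCount (xss ++ yss) ≡ oddCount xss + oddCount yss
  oddCount-++ xss yss = trans (cong sum (map-++ oddness-of xss yss)) (sum-++ (map oddness-of xss) _)
    where
    oddness-of : List A → ℕ
    oddness-of = oddness ∘ parity ∘ length

  oddCount-allOdd : ∀ {xss} → All OddLength xss → oddCount xss ≡ length xss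
  oddCount-allOdd []          = refl
  oddCount-allOdd (odd ∷ all) = cong₂ _+_ (cong oddness odd) (oddCount-allOdd all)

module _ (G : Graph) where

  private
    Vertex : Set
    Vertex = Fin (V G)
    Edge : Set
    Edge = Fin (E G)
    open DecMembership {A = Vertex} _≟_ using (_∈?_)

  edges : List (Dart G) → List Edge
  edges = map (edgeOf G)

  vertices : List (Dart G) → List Vertex
  vertices = map (tail G)

  Joins : Vertex → Vertex → List (Dart G) → Set
  Joins u v []       = u ≡ v
  Joins u v (d ∷ ds) = tail G d ≡ u × Joins (head G d) v ds

  joins-++ : ∀ {u v w} ds {ds′} → Joins u v ds → Joins v w ds′ → Joins u w (ds ++ ds′)
  joins-++ []       refl          j′ = j′
  joins-++ (d ∷ ds) (tail≡ , j)  j′ = tail≡ , joins-++ ds j j′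

  joins-++⁻ : ∀ {u w} ds {ds′} → Joins u w (ds ++ ds′) → ∃[ v ] Joins u v ds × Joins v w ds′
  joins-++⁻ {u} []       j           = u , refl , j
  joins-++⁻     (d ∷ ds) (tail≡ , j) with v , jds , jds′ ← joins-++⁻ ds j = v , (tail≡ , jds) , jds′

  consecutive⇒joins : ∀ d ds {v} → Consecutive G (d ∷ ds) → lastHead G d ds ≡ v → Joins (head G d) v ds
  consecutive⇒joins d []         _            last≡ = last≡
  consecutive⇒joins d (d′ ∷ ds) (meet , cons) last≡ = sym meet , consecutive⇒joins d′ ds cons last≡

  joins⇒consecutive : ∀ d ds {v} → Joins (head G d) v ds → Consecutive G (d ∷ ds) × lastHead G d ds ≡ v
  joins⇒consecutive d []         j             = _ , j
  joins⇒consecutive d (d′ ∷ ds) (tail≡ , j) with cons , last≡ ← joins⇒consecutive d′ ds j =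
    (sym tail≡ , cons) , last≡

  walk⇒joins : ∀ {u v} ds → Walk G u v ds → Joins u v ds
  walk⇒joins []       u≡v                    = u≡v
  walk⇒joins (d ∷ ds) (tail≡ , cons , last≡) = tail≡ , consecutive⇒joins d ds cons last≡

  record IsClosedTrail (T : List (Dart G)) : Set where
    field
      base     : Vertex
      closed   : Joins base base T
      nonEmpty : T ≢ []
      trail    : Unique (edges T)
  open IsClosedTrail public

  fromClosedTrail : ∀ {T} → ClosedTrail G T → IsClosedTrail T
  fromClosedTrail {d ∷ ds} ((_ , cons , last≡) , !T) =
    record { closed = refl , consecutive⇒joins d ds cons last≡ ; nonEmpty = λ () ; trail = !T }

  toClosedTrail : ∀ {T} → IsClosedTrail T → ClosedTrail G T
  toClosedTrail {[]}     t = ⊥-elim (nonEmpty t refl)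
  toClosedTrail {d ∷ ds} record { closed = tail≡ , j ; trail = !T }
    with cons , last≡ ← joins⇒consecutive d ds j = (refl , cons , trans last≡ (sym tail≡)) , !T

  endsAt : Vertex → Edge → ℕ
  endsAt v e = endCount G v (proj₁ (ends G e)) + endCount G v (proj₂ (ends G e))

  deg : Vertex → List Edge → ℕ
  deg v es = sum (map (endsAt v) es)

  parity-deg-↭++ : ∀ v {es} xs ys → es ↭ xs ++ ys →
    parity (deg v es) ≡ parity (deg v xs) ⊕ parity (deg v ys)
  parity-deg-↭++ v {es} xs ys es↭ = begin
    parity (deg v es)                                    ≡⟨ cong parity (sum-↭ (map⁺ (endsAt v) es↭)) ⟩
    parity (sum (map (endsAt v) (xs ++ ys)))             ≡⟨ cong (parity ∘ sum) (map-++ (endsAt v) xs ys) ⟩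
    parity (sum (map (endsAt v) xs ++ map (endsAt v) ys)) ≡⟨ cong parity (sum-++ (map (endsAt v) xs) _) ⟩
    parity (deg v xs + deg v ys)                         ≡⟨ +-homo-+ (deg v xs) (deg v ys) ⟩
    parity (deg v xs) ⊕ parity (deg v ys)                ∎
    where open ≡-Reasoning

  EvenDegrees : List Edge → Set
  EvenDegrees es = ∀ v → parity (deg v es) ≡ 0ℙ

  evenDegrees-residue : ∀ {es} xs ys → es ↭ xs ++ ys → EvenDegrees es → EvenDegrees xs → EvenDegrees ys
  evenDegrees-residue xs ys es↭ even-es even-xs v =
    trans (cong (_⊕ parity (deg v ys)) (sym (even-xs v)))
          (trans (sym (parity-deg-↭++ v xs ys es↭)) (even-es v))

  evenDegrees-++ : ∀ xs ys → EvenDegrees xs → EvenDegrees ys → EvenDegrees (xs ++ ys)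
  evenDegrees-++ xs ys even-xs even-ys v =
    trans (parity-deg-↭++ v xs ys ↭-refl) (cong₂ _⊕_ (even-xs v) (even-ys v))

  δ : Vertex → Vertex → Parity
  δ v w = parity (endCount G v w)

  δ-refl : ∀ v → δ v v ≡ 1ℙ
  δ-refl v with v ≟ v
  ... | yes _  = refl
  ... | no v≢v = ⊥-elim (v≢v refl)

  δ-≢ : ∀ {v w} → v ≢ w → δ v w ≡ 0ℙ
  δ-≢ {v} {w} v≢w with v ≟ w
  ... | yes v≡w = ⊥-elim (v≢w v≡w)
  ... | no _    = refl

  parity-endsAt : ∀ v d → parity (endsAt v (edgeOf G d)) ≡ δ v (tail G d) ⊕ δ v (head G d)
  parity-endsAt v (e , true)  = +-homo-+ (endCount G v (proj₁ (ends G e))) (endCount G v (proj₂ (ends G e)))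
  parity-endsAt v (e , false) =
    trans (+-homo-+ (endCount G v (proj₁ (ends G e))) _) (ℙ.+-comm (δ v (proj₁ (ends G e))) _)

  parity-deg-joins : ∀ v {u w} T → Joins u w T → parity (deg v (edges T)) ≡ δ v u ⊕ δ v w
  parity-deg-joins v {u} []      refl        = sym (p+p≡0ℙ (δ v u))
  parity-deg-joins v {w = w} (d ∷ T) (refl , j) = begin
    parity (endsAt v (edgeOf G d) + deg v (edges T))          ≡⟨ +-homo-+ (endsAt v (edgeOf G d)) _ ⟩
    parity (endsAt v (edgeOf G d)) ⊕ parity (deg v (edges T)) ≡⟨ cong₂ _⊕_ (parity-endsAt v d) (parity-deg-joins v T j) ⟩
    (δ v (tail G d) ⊕ δ v (head G d)) ⊕ (δ v (head G d) ⊕ δ v w) ≡⟨ ⊕-cancel-middle (δ v (tail G d)) _ _ ⟩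
    δ v (tail G d) ⊕ δ v w                                    ∎
    where open ≡-Reasoning

  closedTrail-evenDegrees : ∀ {T} → IsClosedTrail T → EvenDegrees (edges T)
  closedTrail-evenDegrees {T} t v = trans (parity-deg-joins v T (closed t)) (p+p≡0ℙ (δ v (base t)))

  endCount≢0⇒≡ : ∀ v w → endCount G v w ≢ 0 → v ≡ w
  endCount≢0⇒≡ v w endCount≢0 with v ≟ w
  ... | yes v≡w = v≡w
  ... | no _    = ⊥-elim (endCount≢0 refl)

  dartFrom : ∀ v e → endsAt v e ≢ 0 → ∃[ b ] tail G (e , b) ≡ v
  dartFrom v e endsAt≢0 with endCount G v (proj₁ (ends G e)) in count≡
  ... | suc _ = true  , sym (endCount≢0⇒≡ v _ λ count≡0 → 0≢1+n (trans (sym count≡0) count≡))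
  ... | zero  = false , sym (endCount≢0⇒≡ v _ endsAt≢0)

  ClosedTrailSplitting : List Edge → Set
  ClosedTrailSplitting R = ∃[ T ] ∃[ R′ ] IsClosedTrail T × R ↭ edges T ++ R′

  splitting-shorter : ∀ {R T R′} → IsClosedTrail T → R ↭ edges T ++ R′ → length R′ < length R
  splitting-shorter {T = []}    t = ⊥-elim (nonEmpty t refl)
  splitting-shorter {T = d ∷ T} {R′} t R↭ = ↭++-shorterʳ (edges (d ∷ T)) R′ R↭ (λ ())

  edges-∷ʳ : ∀ T d R → edges (T ++ [ d ]) ++ R ≡ edges T ++ edgeOf G d ∷ R
  edges-∷ʳ T d R = trans (cong (_++ R) (map-++ (edgeOf G) T [ d ])) (++-assoc (edges T) _ R)

  module _ {R : List Edge} (!R : Unique R) (even-R : EvenDegrees R) where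

    unusedEdgeAtEnd : ∀ {u x} T {R′} → Joins u x T → x ≢ u → R ↭ edges T ++ R′ →
      ∃[ e ] e ∈ R′ × endsAt x e ≢ 0
    unusedEdgeAtEnd {u} {x} T {R′} j x≢u R↭ = sum≢0⇒∃ (endsAt x) R′ deg≢0
      where
      odd-in-trail : parity (deg x (edges T)) ≡ 1ℙ
      odd-in-trail = trans (parity-deg-joins x T j) (cong₂ _⊕_ (δ-≢ x≢u) (δ-refl x))
      even-total : 0ℙ ≡ 1ℙ ⊕ parity (deg x R′)
      even-total = trans (sym (even-R x)) (trans (parity-deg-↭++ x (edges T) R′ R↭) (cong (_⊕ parity (deg x R′)) odd-in-trail))
      deg≢0 : deg x R′ ≢ 0
      deg≢0 deg≡0 with () ← trans even-total (cong (λ n → 1ℙ ⊕ parity n) deg≡0)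

    extendToClosedTrail : ∀ {u x} T R′ → Acc _<_ (length R′) → Joins u x T → T ≢ [] →
      R ↭ edges T ++ R′ → ClosedTrailSplitting R
    extendToClosedTrail {u} {x} T R′ (acc shorter) j T≢[] R↭ with x ≟ u
    ... | yes refl = T , R′ , record { closed = j ; nonEmpty = T≢[] ; trail = !T } , R↭
      where
      !T : Unique (edges T)
      !T = proj₁ (++-unique⁻ (edges T) (unique-resp-↭ R↭ !R))
    ... | no x≢u
      with e , e∈R′ , endsAt≢0 ← unusedEdgeAtEnd T j x≢u R↭
      with b , tail≡x ← dartFrom x e endsAt≢0
      with R″ , R′↭ ← ∈⇒↭∷ e∈R′
      = extendToClosedTrail (T ++ [ (e , b) ]) R″ (shorter (≤-reflexive (sym (↭-length R′↭))))
          (joins-++ T j (tail≡x , refl)) (T≢[] ∘ ++-conicalˡ T _)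
          (↭-trans R↭ (↭-trans (++⁺ˡ (edges T) R′↭) (↭-reflexive (sym (edges-∷ʳ T (e , b) R″)))))
  closedTrailDecomposition : ∀ R → Acc _<_ (length R) → Unique R → EvenDegrees R →
    ∃[ Ts ] All IsClosedTrail Ts × R ↭ concatMap edges Ts
  closedTrailDecomposition []       _              _  _      = [] , [] , ↭-refl
  closedTrailDecomposition (e ∷ R₀) (acc shorter) !R even-R
    with T , R′ , t , R↭ ← extendToClosedTrail !R even-R [ (e , true) ] R₀ (<-wellFounded _) (refl , refl) (λ ()) ↭-refl
    with !T++R′ ← unique-resp-↭ R↭ !R
    with Ts , ts , R′↭ ← closedTrailDecomposition R′ (shorter (splitting-shorter t R↭))
                           (proj₁ (proj₂ (++-unique⁻ (edges T) !T++R′)))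
                           (evenDegrees-residue (edges T) R′ R↭ even-R (closedTrail-evenDegrees t))
    = T ∷ Ts , t ∷ ts , ↭-trans R↭ (++⁺ˡ (edges T) R′↭)

  joins-heads : ∀ {u v} T → Joins u v T → u ∷ map (head G) T ≡ vertices T ++ [ v ]
  joins-heads []      refl       = refl
  joins-heads (d ∷ T) (refl , j) = cong (tail G d ∷_) (joins-heads T j)

  closedTrail-heads↭vertices : ∀ {T} → IsClosedTrail T → map (head G) T ↭ vertices T
  closedTrail-heads↭vertices {T} t =
    drop-∷ (↭-trans (↭-reflexive (joins-heads T (closed t))) (↭-sym (∷↭∷ʳ (base t) (vertices T))))

  base∈vertices : ∀ {T} (t : IsClosedTrail T) → base t ∈ vertices T
  base∈vertices {[]}    t = ⊥-elim (nonEmpty t refl)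
  base∈vertices {d ∷ T} t = here (sym (proj₁ (closed t)))

  sameEdge-ends : ∀ d d′ → edgeOf G d ≡ edgeOf G d′ →
    (tail G d ≡ tail G d′ ⊎ tail G d ≡ head G d′) × (head G d ≡ tail G d′ ⊎ head G d ≡ head G d′)
  sameEdge-ends (e , true)  (.e , true)  refl = inj₁ refl , inj₂ refl
  sameEdge-ends (e , true)  (.e , false) refl = inj₂ refl , inj₁ refl
  sameEdge-ends (e , false) (.e , true)  refl = inj₂ refl , inj₁ refl
  sameEdge-ends (e , false) (.e , false) refl = inj₁ refl , inj₂ refl

  end∈vertices : ∀ {T d w} → IsClosedTrail T → d ∈ T → w ≡ tail G d ⊎ w ≡ head G d → w ∈ vertices T
  end∈vertices t d∈T (inj₁ refl) = ∈-map⁺ (tail G) d∈T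
  end∈vertices t d∈T (inj₂ refl) = ∈-resp-↭ (closedTrail-heads↭vertices t) (∈-map⁺ (head G) d∈T)

  dart-ends∈vertices : ∀ {T} → IsClosedTrail T → ∀ d → edgeOf G d ∈ edges T →
    tail G d ∈ vertices T × head G d ∈ vertices T
  dart-ends∈vertices t d e∈T
    with d′ , d′∈T , edge≡ ← ∈-map⁻ (edgeOf G) e∈T
    with tail-end , head-end ← sameEdge-ends d d′ edge≡
    = end∈vertices t d′∈T tail-end , end∈vertices t d′∈T head-end

  joins-exit : ∀ {P : Vertex → Set} → Decidable P → ∀ {u v} W → Joins u v W → P u →
    P v ⊎ ∃[ d ] P (tail G d) × ¬ P (head G d)
  joins-exit P? []      refl       Pu = inj₁ Pu
  joins-exit P? (d ∷ W) (refl , j) Pu with P? (head G d)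
  ... | yes Phead = joins-exit P? W j Phead
  ... | no ¬Phead = inj₂ (d , Pu , ¬Phead)

  record ClosedTrailDecomposition (Ts : List (List (Dart G))) : Set where
    field
      closedTrails : All IsClosedTrail Ts
      partition    : allFin (E G) ↭ concatMap edges Ts

    covers : ∀ e → e ∈ concatMap edges Ts
    covers e = ∈-resp-↭ partition (∈-allFin e)

    edgesUnique : Unique (concatMap edges Ts)
    edgesUnique = unique-resp-↭ partition (allFin⁺ (E G))
  open ClosedTrailDecomposition public

  decomposition-↭ : ∀ {Ts Ts′} → Ts ↭ Ts′ → ClosedTrailDecomposition Ts → ClosedTrailDecomposition Ts′
  decomposition-↭ Ts↭ D = record
    { closedTrails = All-resp-↭ Ts↭ (closedTrails D)
    ; partition    = ↭-trans (partition D) (concat-↭ (map⁺ edges Ts↭))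
    }

  parity-oddCount : ∀ Ts → parity (oddCount Ts) ≡ parity (length (concatMap edges Ts))
  parity-oddCount []       = refl
  parity-oddCount (T ∷ Ts) = begin
    parity (oddness (parity (length T)) + oddCount Ts)            ≡⟨ +-homo-+ (oddness (parity (length T))) _ ⟩
    parity (oddness (parity (length T))) ⊕ parity (oddCount Ts)    ≡⟨ cong₂ _⊕_ (parity-oddness (parity (length T))) (parity-oddCount Ts) ⟩
    parity (length T) ⊕ parity (length (concatMap edges Ts))       ≡⟨ cong (λ n → parity n ⊕ _) (sym (length-map (edgeOf G) T)) ⟩
    parity (length (edges T)) ⊕ parity (length (concatMap edges Ts)) ≡⟨ sym (+-homo-+ (length (edges T)) _) ⟩
    parity (length (edges T) + length (concatMap edges Ts))        ≡⟨ cong parity (sym (length-++ (edges T))) ⟩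
    parity (length (concatMap edges (T ∷ Ts)))                     ∎
    where open ≡-Reasoning

  decomposition-parity : ∀ {Ts} → ClosedTrailDecomposition Ts → parity (oddCount Ts) ≡ parity (E G)
  decomposition-parity {Ts} D =
    trans (parity-oddCount Ts) (cong parity (trans (sym (↭-length (partition D))) (length-tabulate {n = E G} id)))

  rotate : ∀ {T v} → IsClosedTrail T → v ∈ vertices T → ∃[ R ] Joins v v R × R ↭ T
  rotate t v∈T
    with d , d∈T , refl ← ∈-map⁻ (tail G) v∈T
    with p , q , refl ← ∈-∃++ d∈T
    with y , jp , (tail≡y , jq) ← joins-++⁻ p (closed t)
    = d ∷ q ++ p
    , (refl , joins-++ q jq (subst (λ z → Joins (base t) z p) (sym tail≡y) jp))
    , ↭-trans (prep d (++-comm q p)) (↭-sym (shift d p q))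

  merge : ∀ {T T′ v} → IsClosedTrail T → IsClosedTrail T′ → Unique (edges (T ++ T′)) →
    v ∈ vertices T → v ∈ vertices T′ → ∃[ M ] IsClosedTrail M × M ↭ T ++ T′
  merge {T} {T′} {v} t t′ !T++T′ v∈T v∈T′
    with R , jR , R↭ ← rotate t v∈T
    with R′ , jR′ , R′↭ ← rotate t′ v∈T′
    = R ++ R′ , m , ++⁺ R↭ R′↭
    where
    m : IsClosedTrail (R ++ R′)
    m = record
      { base     = v
      ; closed   = joins-++ R jR jR′
      ; nonEmpty = λ R++R′≡[] → nonEmpty t (↭-empty-inv (↭-trans (↭-sym R↭) (↭-reflexive (++-conicalˡ R R′ R++R′≡[]))))
      ; trail    = unique-resp-↭ (map⁺ (edgeOf G) (↭-sym (++⁺ R↭ R′↭))) !T++T′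
      }

  edges-++-assoc : ∀ T T′ R → edges T ++ edges T′ ++ R ≡ edges (T ++ T′) ++ R
  edges-++-assoc T T′ R = trans (sym (++-assoc (edges T) (edges T′) R)) (cong (_++ R) (sym (map-++ (edgeOf G) T T′)))

  decomposition-pairUnique : ∀ {T T′ Ts} → ClosedTrailDecomposition (T ∷ T′ ∷ Ts) → Unique (edges (T ++ T′))
  decomposition-pairUnique {T} {T′} {Ts} D =
    proj₁ (++-unique⁻ (edges (T ++ T′)) (subst Unique (edges-++-assoc T T′ (concatMap edges Ts)) (edgesUnique D)))

  mergeTrails : ∀ {T T′ Ts v} → ClosedTrailDecomposition (T ∷ T′ ∷ Ts) →
    v ∈ vertices T → v ∈ vertices T′ →
    ∃[ M ] ClosedTrailDecomposition (M ∷ Ts) × length M ≡ length T + length T′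
  mergeTrails {T} {T′} {Ts} D v∈T v∈T′
    with t ∷ t′ ∷ ts ← closedTrails D
    with M , m , M↭ ← merge t t′ (decomposition-pairUnique D) v∈T v∈T′
    = M , record { closedTrails = m ∷ ts ; partition = partition′ } , trans (↭-length M↭) (length-++ T)
    where
    partition′ : allFin (E G) ↭ edges M ++ concatMap edges Ts
    partition′ = ↭-trans (partition D)
      (↭-trans (↭-reflexive (edges-++-assoc T T′ _)) (++⁺ʳ _ (map⁺ (edgeOf G) (↭-sym M↭))))

  module _ (conn : Connected G) where

    -- Follow a walk from T towards another trail: either it ends on T, or it leaves T along an
    -- edge that, not being an edge of T, belongs to a trail T′ of the rest.
    sharedVertex : ∀ {T Ts} → ClosedTrailDecomposition (T ∷ Ts) → Ts ≢ [] →
      ∃[ T′ ] T′ ∈ Ts × ∃[ v ] v ∈ vertices T × v ∈ vertices T′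
    sharedVertex {Ts = []}      D Ts≢[] = ⊥-elim (Ts≢[] refl)
    sharedVertex {T} {T″ ∷ Ts} D _
      with t ∷ t″ ∷ _ ← closedTrails D
      with W , walk ← conn (base t) (base t″)
      with joins-exit (_∈? vertices T) W (walk⇒joins W walk) (base∈vertices t)
    ... | inj₁ end∈T = T″ , here refl , base t″ , end∈T , base∈vertices t″
    ... | inj₂ (d , tail∈T , head∉T) with ∈-++⁻ (edges T) (covers D (edgeOf G d))
    ...   | inj₁ e∈T = ⊥-elim (head∉T (proj₂ (dart-ends∈vertices t d e∈T)))
    ...   | inj₂ e∈Ts with T′ , T′∈ , e∈T′ ← find (∈-concatMap⁻ edges {xs = T″ ∷ Ts} e∈Ts) =
      T′ , T′∈ , tail G d , tail∈T , proj₁ (dart-ends∈vertices (All.lookup (closedTrails D) (there T′∈)) d e∈T′)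

    mergeTouching : ∀ {T Ts} → ClosedTrailDecomposition (T ∷ Ts) → Ts ≢ [] →
      ∃[ T′ ] ∃[ Ts′ ] ∃[ M ] Ts ↭ T′ ∷ Ts′ × ClosedTrailDecomposition (M ∷ Ts′) × length M ≡ length T + length T′
    mergeTouching {T} D Ts≢[]
      with T′ , T′∈ , v , v∈T , v∈T′ ← sharedVertex D Ts≢[]
      with Ts′ , Ts↭ ← ∈⇒↭∷ T′∈
      with M , D′ , length≡ ← mergeTrails (decomposition-↭ (prep T Ts↭) D) v∈T v∈T′
      = T′ , Ts′ , M , Ts↭ , D′ , length≡

    absorbEvenTrail : ∀ {Ts} → ClosedTrailDecomposition Ts → ¬ All OddLength Ts → 0 < oddCount Ts →
      ∃[ Ts′ ] ClosedTrailDecomposition Ts′ × oddCount Ts′ ≡ oddCount Ts × length Ts′ < length Ts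
    absorbEvenTrail {Ts} D ¬allOdd count>0
      with T , T∈ , ¬oddT ← find (AllP.¬All⇒Any¬ oddLength? Ts ¬allOdd)
      with Ts₀ , Ts↭ ← ∈⇒↭∷ T∈
      = absorb Ts₀ (≢1ℙ⇒≡0ℙ ¬oddT) Ts↭
      where
      absorb : ∀ {T} Ts₀ → parity (length T) ≡ 0ℙ → Ts ↭ T ∷ Ts₀ →
        ∃[ Ts′ ] ClosedTrailDecomposition Ts′ × oddCount Ts′ ≡ oddCount Ts × length Ts′ < length Ts
      absorb [] evenT Ts↭ = ⊥-elim (<-irrefl (sym (trans (oddCount-↭ Ts↭) (cong (λ p → oddness p + 0) evenT))) count>0)
      absorb {T} Ts₀@(_ ∷ _) evenT Ts↭
        with T′ , Ts′ , M , Ts₀↭ , D′ , length≡ ← mergeTouching (decomposition-↭ Ts↭ D) (λ ())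
        = M ∷ Ts′ , D′ , count≡ , ≤-reflexive (sym length≡′)
        where
        open ≡-Reasoning
        parityM : parity (length M) ≡ parity (length T′)
        parityM = trans (cong parity length≡) (trans (+-homo-+ (length T) (length T′)) (cong (_⊕ _) evenT))
        count≡ : oddCount (M ∷ Ts′) ≡ oddCount Ts
        count≡ = begin
          oddness (parity (length M)) + oddCount Ts′   ≡⟨ cong (λ p → oddness p + oddCount Ts′) parityM ⟩
          oddCount (T′ ∷ Ts′)                          ≡⟨ oddCount-↭ (↭-sym Ts₀↭) ⟩
          oddCount Ts₀                                 ≡⟨ cong (λ p → oddness p + oddCount Ts₀) (sym evenT) ⟩
          oddCount (T ∷ Ts₀)                           ≡⟨ oddCount-↭ (↭-sym Ts↭) ⟩
          oddCount Ts                                  ∎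
        length≡′ : length Ts ≡ suc (length (M ∷ Ts′))
        length≡′ = trans (↭-length Ts↭) (cong suc (↭-length Ts₀↭))

    mergeOddPair : ∀ {Ts} → ClosedTrailDecomposition Ts → All OddLength Ts → 2 ≤ length Ts →
      ∃[ Ts′ ] ClosedTrailDecomposition Ts′ × 2 + oddCount Ts′ ≡ oddCount Ts × length Ts′ < length Ts
    mergeOddPair {_ ∷ []} _ _ (s≤s ())
    mergeOddPair {T ∷ Ts₀@(_ ∷ _)} D (oddT ∷ allOdd) _
      with T′ , Ts′ , M , Ts₀↭ , D′ , length≡ ← mergeTouching D (λ ())
      with oddT′ ∷ _ ← All-resp-↭ Ts₀↭ allOdd
      = M ∷ Ts′ , D′ , count≡ , s≤s (≤-reflexive (sym (↭-length Ts₀↭)))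
      where
      open ≡-Reasoning
      evenM : parity (length M) ≡ 0ℙ
      evenM = trans (cong parity length≡) (trans (+-homo-+ (length T) (length T′)) (cong₂ _⊕_ oddT oddT′))
      count≡ : 2 + oddCount (M ∷ Ts′) ≡ oddCount (T ∷ Ts₀)
      count≡ = begin
        2 + (oddness (parity (length M)) + oddCount Ts′)   ≡⟨ cong (λ p → 2 + (oddness p + oddCount Ts′)) evenM ⟩
        1 + (1 + oddCount Ts′)                             ≡⟨ cong (λ p → 1 + (oddness p + oddCount Ts′)) (sym oddT′) ⟩
        1 + oddCount (T′ ∷ Ts′)                            ≡⟨ cong (1 +_) (oddCount-↭ (↭-sym Ts₀↭)) ⟩
        1 + oddCount Ts₀                                   ≡⟨ cong (λ p → oddness p + oddCount Ts₀) (sym oddT) ⟩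
        oddCount (T ∷ Ts₀)                                 ∎

    module _ {k : ℕ} (k>0 : k > 0) (parity-k : parity k ≡ parity (E G)) where

      reduceToOddTrails : ∀ Ts → Acc _<_ (length Ts) → ClosedTrailDecomposition Ts → k ≤ oddCount Ts →
        ∃[ Ts′ ] ClosedTrailDecomposition Ts′ × All OddLength Ts′ × length Ts′ ≡ k
      reduceToOddTrails Ts (acc smaller) D k≤count with all? oddLength? Ts
      ... | no ¬allOdd
        with Ts′ , D′ , count≡ , shorter ← absorbEvenTrail D ¬allOdd (≤-trans k>0 k≤count)
        = reduceToOddTrails Ts′ (smaller shorter) D′ (subst (k ≤_) (sym count≡) k≤count)
      ... | yes allOdd with length Ts ℕ.≟ k
      ...   | yes length≡k = Ts , D , allOdd , length≡k
      ...   | no length≢k =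
        let Ts′ , D′ , count≡ , shorter = mergeOddPair D allOdd (≤-trans (m≤m+n 2 k) k+2≤length)
        in  reduceToOddTrails Ts′ (smaller shorter) D′ (+-cancelˡ-≤ 2 k _ (subst (2 + k ≤_) (sym count≡) k+2≤count))
        where
        count≡length : oddCount Ts ≡ length Ts
        count≡length = oddCount-allOdd allOdd
        k+2≤count : 2 + k ≤ oddCount Ts
        k+2≤count = ≤-parity-gap k≤count (trans parity-k (sym (decomposition-parity D)))
                      (λ k≡count → length≢k (sym (trans k≡count count≡length)))
        k+2≤length : 2 + k ≤ length Ts
        k+2≤length = subst (2 + k ≤_) count≡length k+2≤count

  toOddDecomposition : ∀ {Ts} → ClosedTrailDecomposition Ts → All OddLength Ts → OddDecomposition G (length Ts)
  toOddDecomposition {Ts} D allOdd = class , λ i →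
      lookup Ts i
    , toClosedTrail (All.lookup (closedTrails D) (∈-lookup i))
    , (λ e → mk⇔ (λ e∈ → concatMap-unique-index edges Ts (edgesUnique D) (class e) i (trailOf e) e∈)
                 (λ { refl → trailOf e }))
    , parity≡1ℙ⇒¬2∣ (All.lookup allOdd (∈-lookup i))
    where
    containing : ∀ e → Any (λ T → e ∈ edges T) Ts
    containing e = ∈-concatMap⁻ edges (covers D e)
    class : Edge → Fin (length Ts)
    class e = Any.index (containing e)
    trailOf : ∀ e → e ∈ edges (lookup Ts (class e))
    trailOf e = lookup-index (containing e)

  closedTrails-evenDegrees : ∀ {Ts} → All IsClosedTrail Ts → EvenDegrees (concatMap edges Ts)
  closedTrails-evenDegrees []       v = refl
  closedTrails-evenDegrees {T ∷ Ts} (t ∷ ts) =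
    evenDegrees-++ (edges T) (concatMap edges Ts) (closedTrail-evenDegrees t) (closedTrails-evenDegrees ts)

  extendToDecomposition : (∀ v → 2 ∣ degree G v) → ∀ {Cs} → All IsClosedTrail Cs → Unique (concatMap edges Cs) →
    ∃[ Ds ] ClosedTrailDecomposition (Cs ++ Ds)
  extendToDecomposition even-degree {Cs} cs !Cs =
    let R , allFin↭         = ⊆⇒↭++ !Cs (λ {e} _ → ∈-allFin e)
        _ , !R , _          = ++-unique⁻ (concatMap edges Cs) (unique-resp-↭ allFin↭ (allFin⁺ (E G)))
        even-R              = evenDegrees-residue (concatMap edges Cs) R allFin↭
                                (λ v → 2∣⇒parity≡0ℙ (even-degree v)) (closedTrails-evenDegrees cs)
        Ds , ds , R↭        = closedTrailDecomposition R (<-wellFounded (length R)) !R even-R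
    in  Ds , record
          { closedTrails = AllP.++⁺ cs ds
          ; partition    = ↭-trans allFin↭ (↭-trans (++⁺ˡ (concatMap edges Cs) R↭)
                                                     (↭-reflexive (sym (concatMap-++ edges Cs Ds))))
          }

  packing⇒oddDecomposition : Eulerian G → ∀ {k} → k > 0 → parity k ≡ parity (E G) →
    OddCircuitPacking G k → OddDecomposition G k
  packing⇒oddDecomposition (conn , even-degree) {k} k>0 parity-k (C , circuit , disjoint) =
    let Ds , D                      = extendToDecomposition even-degree cs !Cs
        Ts , D′ , allOdd , length≡k = reduceToOddTrails conn k>0 parity-k (Cs ++ Ds) (<-wellFounded _) D (k≤oddCount Ds)
    in  subst (OddDecomposition G) length≡k (toOddDecomposition D′ allOdd)
    where
    Cs : List (List (Dart G))
    Cs = tabulate C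
    cs : All IsClosedTrail Cs
    cs = AllP.tabulate⁺ (λ i → fromClosedTrail (proj₁ (proj₁ (circuit i))))
    !Cs : Unique (concatMap edges Cs)
    !Cs = subst (Unique ∘ concat) (sym (map-tabulate C edges))
            (concat⁺ (AllP.tabulate⁺ (λ i → trail (All.lookup cs (∈-tabulate⁺ i))))
                     (AllPairsP.tabulate⁺ λ {i} {j} i≢j (e∈i , e∈j) → disjoint i j i≢j _ e∈i e∈j))
    k≤oddCount : ∀ Ds → k ≤ oddCount (Cs ++ Ds)
    k≤oddCount Ds = begin
      k                             ≡⟨ sym (length-tabulate C) ⟩
      length Cs                     ≡⟨ sym (oddCount-allOdd (AllP.tabulate⁺ (λ i → ¬2∣⇒parity≡1ℙ _ (proj₂ (circuit i))))) ⟩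
      oddCount Cs                   ≤⟨ m≤m+n (oddCount Cs) (oddCount Ds) ⟩
      oddCount Cs + oddCount Ds     ≡⟨ sym (oddCount-++ Cs Ds) ⟩
      oddCount (Cs ++ Ds)           ∎
      where open ≤-Reasoning

  edges-↭++ : ∀ {T} A B → T ↭ A ++ B → edges T ↭ edges A ++ edges B
  edges-↭++ A B T↭ = ↭-trans (map⁺ (edgeOf G) T↭) (↭-reflexive (map-++ (edgeOf G) A B))

  splitAtRepeatedVertex : ∀ p d q d′ r → IsClosedTrail (p ++ d ∷ q ++ d′ ∷ r) → tail G d ≡ tail G d′ →
    ∃[ A ] ∃[ B ] IsClosedTrail A × IsClosedTrail B × p ++ d ∷ q ++ d′ ∷ r ↭ A ++ B
  splitAtRepeatedVertex p d q d′ r t tail≡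
    with y , jp , (tail≡y , jq) ← joins-++⁻ p (closed t)
    with z , jq′ , (tail′≡z , jr) ← joins-++⁻ q jq
    = d ∷ q , p ++ d′ ∷ r
    , record { closed   = refl , subst (λ w → Joins (head G d) w q) (trans (sym tail′≡z) (sym tail≡)) jq′
             ; nonEmpty = λ ()
             ; trail    = proj₁ !A++B }
    , record { closed   = joins-++ p jp (trans (sym tail≡) tail≡y , jr)
             ; nonEmpty = λ B≡[] → case ++-conicalʳ p (d′ ∷ r) B≡[] of λ ()
             ; trail    = proj₁ (proj₂ !A++B) }
    , shifts p (d ∷ q)
    where
    !A++B : Unique (edges (d ∷ q)) × Unique (edges (p ++ d′ ∷ r)) × Disjoint (edges (d ∷ q)) (edges (p ++ d′ ∷ r))
    !A++B = ++-unique⁻ (edges (d ∷ q)) (subst Unique (map-++ (edgeOf G) (d ∷ q) (p ++ d′ ∷ r))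
              (unique-resp-↭ (map⁺ (edgeOf G) (shifts p (d ∷ q))) (trail t)))

  record OddCircuitIn (T : List (Dart G)) : Set where
    field
      circuit     : List (Dart G)
      closedTrail : IsClosedTrail circuit
      simple      : Unique (vertices circuit)
      odd         : OddLength circuit
      ⊆trail      : edges circuit ⊆ edges T

  oddCircuitIn-⊆ : ∀ {T T′} → edges T ⊆ edges T′ → OddCircuitIn T → OddCircuitIn T′
  oddCircuitIn-⊆ T⊆T′ c = record { OddCircuitIn c ; ⊆trail = T⊆T′ ∘ OddCircuitIn.⊆trail c }

  oddCircuitIn : ∀ T → Acc _<_ (length T) → IsClosedTrail T → OddLength T → OddCircuitIn T
  oddCircuitIn T (acc shorter) t oddT with uniqueOrRepeated (tail G) _≟_ T
  ... | inj₁ !vertices = record { closedTrail = t ; simple = !vertices ; odd = oddT ; ⊆trail = id }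
  ... | inj₂ (p , d , q , d′ , r , refl , tail≡)
    with A , B , a , b , T↭ ← splitAtRepeatedVertex p d q d′ r t tail≡
    with oddLength? A
  ...   | yes oddA = oddCircuitIn-⊆ (↭++-⊆ˡ (edges A) (edges B) (edges-↭++ A B T↭))
                       (oddCircuitIn A (shorter (↭++-shorterˡ A B T↭ (nonEmpty b))) a oddA)
  ...   | no ¬oddA = oddCircuitIn-⊆ (↭++-⊆ʳ (edges A) (edges B) (edges-↭++ A B T↭))
                       (oddCircuitIn B (shorter (↭++-shorterʳ A B T↭ (nonEmpty a))) b oddB)
    where
    oddB : OddLength B
    oddB = trans (sym (trans (parity-length-↭++ A B T↭) (cong (_⊕ parity (length B)) (≢1ℙ⇒≡0ℙ ¬oddA)))) oddT

  oddDecomposition⇒packing : ∀ {k} → OddDecomposition G k → OddCircuitPacking G k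
  oddDecomposition⇒packing (class , classTrail) =
      circuit ∘ oddCircuit
    , (λ i → (toClosedTrail (closedTrail (oddCircuit i)) , simple (oddCircuit i)) , parity≡1ℙ⇒¬2∣ (odd (oddCircuit i)))
    , λ i j i≢j e e∈i e∈j → i≢j (trans (sym (inClass i e∈i)) (inClass j e∈j))
    where
    open OddCircuitIn
    oddCircuit : ∀ i → OddCircuitIn (proj₁ (classTrail i))
    oddCircuit i with T , t , _ , oddT ← classTrail i =
      oddCircuitIn T (<-wellFounded (length T)) (fromClosedTrail t) (¬2∣⇒parity≡1ℙ (length T) oddT)
    inClass : ∀ i {e} → e ∈ edges (circuit (oddCircuit i)) → class e ≡ i
    inClass i e∈ = Equivalence.to (proj₁ (proj₂ (proj₂ (classTrail i))) _) (⊆trail (oddCircuit i) e∈)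

theorem3p1 : (G : Graph) → Eulerian G → (k : ℕ) → k > 0 → k % 2 ≡ E G % 2 →
    OddDecomposition G k ⇔ OddCircuitPacking G k
theorem3p1 G eulerian k k>0 k≡E =
  mk⇔ (oddDecomposition⇒packing G)
      (packing⇒oddDecomposition G eulerian k>0 (%2≡⇒parity≡ k (E G) k≡E))
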